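{- For every prime $p\ge 5$ with $p\equiv 2\pmod 3$, \[ A_p^{\mathrm{mix}}\equiv 72\pmod p. \] In particular $A_p^{\mathrm{mix}}-A_1^{\mathrm{mix}}\equiv 54\not\equiv 0\pmod p$.
   Context: $A_n^{\mathrm{mix}}:=108^n[z^n]\,{}_2F_1(\tfrac16,\tfrac13;1;z)^3$; in particular $A_1^{\mathrm{mix}}=18$. -}

module Defs where

open import Data.Nat as ℕ using (ℕ; zero; suc; _∸_; _!)
open import Data.Nat.Properties using (_!*_!≢0)
open import Data.Integer as ℤ using (ℤ; +_)
open import Data.Integer.Divisibility as ℤᵈ using ()
open import Data.Rational.Unnormalised as ℚ using (ℚᵘ; _/_; _≃_; 1ℚᵘ)
open import Data.Product using (Σ; ∃₂; _×_)
open import Relation.Nullary using (¬_)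

_^ᵘ_ : ℚᵘ → ℕ → ℚᵘ
x ^ᵘ zero  = 1ℚᵘ
x ^ᵘ suc n = x ℚ.* (x ^ᵘ n)

sumTo : ℕ → (ℕ → ℚᵘ) → ℚᵘ
sumTo zero    f = f 0
sumTo (suc n) f = sumTo n f ℚ.+ f (suc n)

poch : ℚᵘ → ℕ → ℚᵘ
poch a zero    = 1ℚᵘ
poch a (suc k) = poch a k ℚ.* (a ℚ.+ (+ k / 1))

-- [z^k] 2F1(1/6,1/3;1;z) = (1/6)_k (1/3)_k / ((1)_k k!) = (1/6)_k (1/3)_k / (k!)^2
hypCoeff : ℕ → ℚᵘ
hypCoeff k = (poch (+ 1 / 6) k ℚ.* poch (+ 1 / 3) k)
             ℚ.* ((+ 1 / (k ! ℕ.* k !)) {{k !* k !≢0}})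

-- [z^n] F(z)^3 = ∑_{i+j+l=n} F_i F_j F_l
cubeCoeff : ℕ → ℚᵘ
cubeCoeff n = sumTo n (λ i → sumTo (n ∸ i) (λ j →
                hypCoeff i ℚ.* hypCoeff j ℚ.* hypCoeff (n ∸ i ∸ j)))

Amix : ℕ → ℚᵘ
Amix n = ((+ 108 / 1) ^ᵘ n) ℚ.* cubeCoeff n

_≡ᵘ_[mod_] : ℚᵘ → ℚᵘ → ℕ → Set
x ≡ᵘ y [mod p ] = ∃₂ λ (a b : ℤ) →
  (¬ ((+ p) ℤᵈ.∣ b)) × ((b / 1) ℚ.* (x ℚ.- y) ≃ (+ p / 1) ℚ.* (a / 1))

-- Let hₖ = (1/6)ₖ(1/3)ₖ/k!² be the coefficients of F = ₂F₁(1/6,1/3;1;z) and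
-- cₖ = (1/3)ₖ(2/3)ₖ(1/2)ₖ/k!³.  Clausen's formula F² = ₃F₂(1/3,2/3,1/2;1,1;z), i.e.
-- Σⱼ hⱼ hₙ₋ⱼ = cₙ, holds because both sides satisfy the same first-order recurrence; for the
-- convolution this is checked with an explicit Zeilberger certificate.  Hence [zᵖ]F³ = Σᵢ hᵢ cₚ₋ᵢ.
--
-- Write p = 6s + 5.  The factor 1/3 + (4s+3) = p·2/3 of (1/3)ᵢ makes hᵢ ≡ 0 (mod p) for
-- 4s+3 < i < p, and the factor 2/3 + (2s+1) = p·1/3 of (2/3)ₖ makes cₖ ≡ 0 for 2s+1 < k < p.
-- Every term with 0 < i < p has one of the two properties, so [zᵖ]F³ ≡ c₀hₚ + h₀cₚ = hₚ + cₚ.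
-- If α + t = pγ with t < p, then (α)ₚ/p! ≡ γ: the factor α + t cancels the p of p!, and the
-- other factors α + j ≡ j − t run through the non-zero residues, cancelling (p−1)!.  Hence
-- hₚ ≡ (5/6)(2/3), cₚ ≡ (2/3)(1/3)(1/2) and [zᵖ]F³ ≡ 2/3.  With Fermat's 108ᵖ ≡ 108 this gives
-- Aₚ ≡ 72, while A₁ = 18 and p ∤ 54.

{-# OPTIONS --safe #-}
module Submission where

open import Defs
open import Data.Nat as ℕ using (ℕ; zero; suc; _∸_; _!; _≤_; _<_; _≥_; _%_; NonZero)
open import Data.Nat.Properties using (_!≢0; _!*_!≢0)
import Data.Nat.Properties as ℕ
open import Data.Nat.Divisibility as ℕ using (divides)
open import Data.Nat.DivMod using (m≡m%n+[m/n]*n; m%n<n; m*[n/m]≡n)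
open import Data.Nat.Combinatorics using (_C_; nCn≡1; k![n∸k]!∣n!; nCk≡n!/k![n-k]!)
open import Data.Nat.Primality using (Prime; euclidsLemma; prime⇒nonZero; prime⇒nonTrivial; prime⇒irreducible)
import Data.Nat.Tactic.RingSolver as ℕ-Solver
open import Data.Integer as ℤ using (ℤ; +_)
import Data.Integer.Properties as ℤ
open import Data.Integer.Divisibility as ℤ using ()
open import Data.Fin as Fin using (Fin; toℕ; fromℕ; inject₁)
import Data.Fin.Properties as Fin
open import Data.Rational.Unnormalised
  using (ℚᵘ; _/_; _≃_; *≡*; 0ℚᵘ; 1ℚᵘ; _+_; _*_; -_; _-_; 1/_)
open import Data.Rational.Unnormalised.Properties
  using (≃-refl; ≃-sym; ≃-trans; ≃-reflexive; _≃?_; drop-*≡*; +-cong; +-congˡ; +-congʳ;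
         *-cong; *-congˡ; *-congʳ; +-assoc; +-comm; +-identityʳ; +-inverseʳ; +-minus-telescope; -‿cong;
         *-assoc; *-comm; *-identityˡ; *-identityʳ; *-zeroˡ; *-inverseʳ; *-distribˡ-+; *-cancelˡ-/;
         +-*-commutativeRing; +-0-monoid; module ≃-Reasoning)
open import Data.Bool using (T)
open import Data.Product using (∃; _×_; _,_)
open import Data.Sum using (_⊎_; inj₁; inj₂)
open import Data.Vec.Functional using (Vector; init; last)
open import Function using (_∘_; _∘′_)
open import Relation.Binary.PropositionalEquality using (_≡_; refl; sym; trans; cong; cong₂; subst)
open import Relation.Nullary using (¬_; Dec; contradiction; yes; no)
open import Relation.Nullary.Decidable using (dec⇒maybe)
open import Algebra.Bundles using (Monoid; CommutativeRing; CommutativeSemiring)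
open import Algebra.Definitions.RawMonoid (Monoid.rawMonoid +-0-monoid) using () renaming (_×_ to _×ᵘ_)
open import Algebra.Properties.Monoid.Sum +-0-monoid using (sum; sum-init-last)
import Algebra.Properties.CommutativeSemiring.Binomial as Binomial
open import Tactic.RingSolver.Core.AlmostCommutativeRing using (AlmostCommutativeRing; fromCommutativeRing)
open import Tactic.RingSolver using (solve-∀)

open ≃-Reasoning

ℚᵘ-ring : AlmostCommutativeRing _ _
ℚᵘ-ring = fromCommutativeRing +-*-commutativeRing (λ x → dec⇒maybe (0ℚᵘ ≃? x))

/1-homo-+ : ∀ a b → (a ℤ.+ b) / 1 ≡ a / 1 + b / 1
/1-homo-+ a b = cong (_/ 1) (sym (cong₂ ℤ._+_ (ℤ.*-identityʳ a) (ℤ.*-identityʳ b)))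

ι : ℕ → ℚᵘ
ι n = + n / 1

ι-+ : ∀ m n → ι (m ℕ.+ n) ≡ ι m + ι n
ι-+ m n = trans (cong (_/ 1) (ℤ.pos-+ m n)) (/1-homo-+ (+ m) (+ n))

ι-* : ∀ m n → ι (m ℕ.* n) ≡ ι m * ι n
ι-* m n = cong (_/ 1) (ℤ.pos-* m n)

ι-suc : ∀ n → ι (suc n) ≡ ι n + 1ℚᵘ
ι-suc n = trans (cong ι (ℕ.+-comm 1 n)) (ι-+ n 1)

*-cancelʳ-ι : ∀ {x y} n .{{_ : NonZero n}} → x * ι n ≃ y * ι n → x ≃ y
*-cancelʳ-ι {x} {y} (suc n) eq = begin
  x                                ≈⟨ undo x ⟨
  x * ι (suc n) * 1/ ι (suc n)     ≈⟨ *-congʳ eq ⟩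
  y * ι (suc n) * 1/ ι (suc n)     ≈⟨ undo y ⟩
  y                                ∎
  where
  undo : ∀ z → z * ι (suc n) * 1/ ι (suc n) ≃ z
  undo z = ≃-trans (*-assoc z _ _) (≃-trans (*-congˡ {z} (*-inverseʳ (ι (suc n)))) (*-identityʳ z))

1/[m*n]≃1/m*1/n : ∀ m n .{{_ : NonZero m}} .{{_ : NonZero n}} .{{_ : NonZero (m ℕ.* n)}} →
                  + 1 / (m ℕ.* n) ≃ (+ 1 / m) * (+ 1 / n)
1/[m*n]≃1/m*1/n (suc m) (suc n) = ≃-refl

e/d*d≃e : ∀ e d .{{_ : NonZero d}} → (+ e / d) * ι d ≃ ι e
e/d*d≃e e (suc d) = ≃-trans (≃-reflexive (cong (_/ (suc d ℕ.* 1)) (ℤ.*-comm (+ e) (+ suc d))))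
                            (*-cancelˡ-/ (suc d))

fraction-shift : ∀ e d t n c .{{_ : NonZero d}} → d ℕ.* t ℕ.+ e ≡ n ℕ.* c → + e / d + ι t ≃ ι n * (+ c / d)
fraction-shift e d t n c eq = *-cancelʳ-ι d (begin
  (+ e / d + ι t) * ι d        ≈⟨ expand (+ e / d) (ι t) (ι d) ⟩
  ι d * ι t + + e / d * ι d    ≈⟨ +-congʳ (ι d * ι t) (e/d*d≃e e d) ⟩
  ι d * ι t + ι e              ≡⟨ trans (ι-+ (d ℕ.* t) e) (cong (_+ ι e) (ι-* d t)) ⟨
  ι (d ℕ.* t ℕ.+ e)            ≡⟨ trans (cong ι eq) (ι-* n c) ⟩
  ι n * ι c                    ≈⟨ *-congˡ {ι n} (e/d*d≃e c d) ⟨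
  ι n * (+ c / d * ι d)        ≈⟨ *-assoc (ι n) (+ c / d) (ι d) ⟨
  ι n * (+ c / d) * ι d        ∎)
  where
  expand : ∀ a T D → (a + T) * D ≃ D * T + a * D
  expand = solve-∀ ℚᵘ-ring

ℚᵘ-commutativeSemiring : CommutativeSemiring _ _
ℚᵘ-commutativeSemiring = CommutativeRing.commutativeSemiring +-*-commutativeRing
open Binomial ℚᵘ-commutativeSemiring using () renaming (theorem to binomial-theorem)
open import Algebra.Definitions.RawSemiring (CommutativeSemiring.rawSemiring ℚᵘ-commutativeSemiring) using (_^_)

^≡^ᵘ : ∀ x n → x ^ n ≡ x ^ᵘ n
^≡^ᵘ x zero    = refl
^≡^ᵘ x (suc n) = cong (x *_) (^≡^ᵘ x n)

1^n≃1 : ∀ n → 1ℚᵘ ^ᵘ n ≃ 1ℚᵘ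
1^n≃1 zero    = ≃-refl
1^n≃1 (suc n) = *-congˡ {1ℚᵘ} (1^n≃1 n)

×≃ι* : ∀ n z → n ×ᵘ z ≃ ι n * z
×≃ι* zero    z = ≃-sym (*-zeroˡ z)
×≃ι* (suc n) z = begin
  z + n ×ᵘ z         ≈⟨ +-congʳ z (×≃ι* n z) ⟩
  z + ι n * z        ≈⟨ collect z (ι n) ⟩
  (ι n + 1ℚᵘ) * z    ≡⟨ cong (_* z) (ι-suc n) ⟨
  ι (suc n) * z      ∎
  where
  collect : ∀ z N → z + N * z ≃ (N + 1ℚᵘ) * z
  collect = solve-∀ ℚᵘ-ring

sumTo-cong : ∀ n {f g : ℕ → ℚᵘ} → (∀ i → f i ≃ g i) → sumTo n f ≃ sumTo n g
sumTo-cong zero    f≃g = f≃g 0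
sumTo-cong (suc n) f≃g = +-cong (sumTo-cong n f≃g) (f≃g (suc n))

*-distribˡ-sumTo : ∀ n c (f : ℕ → ℚᵘ) → c * sumTo n f ≃ sumTo n (λ i → c * f i)
*-distribˡ-sumTo zero    c f = ≃-refl
*-distribˡ-sumTo (suc n) c f =
  ≃-trans (*-distribˡ-+ c (sumTo n f) (f (suc n))) (+-cong (*-distribˡ-sumTo n c f) ≃-refl)

sumTo-telescope : ∀ n (f g T : ℕ → ℚᵘ) → (∀ j → j ≤ n → f j + T (suc j) ≃ g j + T j) →
                  sumTo n f + T (suc n) ≃ sumTo n g + T 0
sumTo-telescope zero    f g T step = step 0 ℕ.z≤n
sumTo-telescope (suc n) f g T step = begin
  sumTo n f + f (suc n) + T (suc (suc n))    ≈⟨ +-assoc (sumTo n f) _ _ ⟩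
  sumTo n f + (f (suc n) + T (suc (suc n)))  ≈⟨ +-congʳ (sumTo n f) (step (suc n) ℕ.≤-refl) ⟩
  sumTo n f + (g (suc n) + T (suc n))        ≈⟨ shuffle (sumTo n f) (g (suc n)) (T (suc n)) ⟩
  sumTo n f + T (suc n) + g (suc n)          ≈⟨ +-cong (sumTo-telescope n f g T step′) ≃-refl ⟩
  sumTo n g + T 0 + g (suc n)                ≈⟨ +-cong (+-comm (sumTo n g) (T 0)) ≃-refl ⟩
  T 0 + sumTo n g + g (suc n)                ≈⟨ +-assoc (T 0) _ _ ⟩
  T 0 + sumTo (suc n) g                      ≈⟨ +-comm (T 0) _ ⟩
  sumTo (suc n) g + T 0                      ∎
  where
  step′ : ∀ j → j ≤ n → f j + T (suc j) ≃ g j + T j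
  step′ j j≤n = step j (ℕ.m≤n⇒m≤1+n j≤n)
  shuffle : ∀ a b c → a + (b + c) ≃ a + c + b
  shuffle = solve-∀ ℚᵘ-ring

-- Pochhammer symbols

poch-+ : ∀ α m n → poch α (m ℕ.+ n) ≃ poch α m * poch (α + ι m) n
poch-+ α m zero    = ≃-trans (≃-reflexive (cong (poch α) (ℕ.+-identityʳ m))) (≃-sym (*-identityʳ _))
poch-+ α m (suc n) = begin
  poch α (m ℕ.+ suc n)
    ≡⟨ cong (poch α) (ℕ.+-suc m n) ⟩
  poch α (m ℕ.+ n) * (α + ι (m ℕ.+ n))
    ≈⟨ *-cong (poch-+ α m n) (≃-reflexive (cong (λ x → α + x) (ι-+ m n))) ⟩
  poch α m * poch (α + ι m) n * (α + (ι m + ι n))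
    ≈⟨ reassoc (poch α m) (poch (α + ι m) n) α (ι m) (ι n) ⟩
  poch α m * poch (α + ι m) (suc n)
    ∎
  where
  reassoc : ∀ P Q a b c → P * Q * (a + (b + c)) ≃ P * (Q * (a + b + c))
  reassoc = solve-∀ ℚᵘ-ring

poch-suc : ∀ α n → poch α (suc n) ≃ α * poch (α + 1ℚᵘ) n
poch-suc α n = ≃-trans (poch-+ α 1 n) (*-cong (unit α) ≃-refl)
  where
  unit : ∀ a → 1ℚᵘ * (a + 0ℚᵘ) ≃ a
  unit = solve-∀ ℚᵘ-ring

poch-1 : ∀ n → poch 1ℚᵘ n ≃ ι (n !)
poch-1 zero    = ≃-refl
poch-1 (suc n) = begin
  poch 1ℚᵘ n * (1ℚᵘ + ι n)   ≈⟨ *-cong (poch-1 n) (≃-reflexive (sym (ι-+ 1 n))) ⟩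
  ι (n !) * ι (suc n)         ≈⟨ *-comm (ι (n !)) _ ⟩
  ι (suc n) * ι (n !)         ≡⟨ ι-* (suc n) (n !) ⟨
  ι (suc n !)                 ∎

invFact : ℕ → ℚᵘ
invFact k = (+ 1 / k !) {{k !≢0}}

ι!*invFact : ∀ k → ι (k !) * invFact k ≃ 1ℚᵘ
ι!*invFact k = ≃-trans (*-comm (ι (k !)) (invFact k)) (e/d*d≃e 1 (k !) {{k !≢0}})

invFact-suc : ∀ k → invFact (suc k) * ι (suc k) ≃ invFact k
invFact-suc k = begin
  invFact (suc k) * ι (suc k)                   ≈⟨ *-cong split ≃-refl ⟩
  (+ 1 / suc k) * invFact k * ι (suc k)         ≈⟨ swap (+ 1 / suc k) (invFact k) (ι (suc k)) ⟩
  invFact k * ((+ 1 / suc k) * ι (suc k))       ≈⟨ *-congˡ {invFact k} (e/d*d≃e 1 (suc k)) ⟩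
  invFact k * 1ℚᵘ                               ≈⟨ *-identityʳ _ ⟩
  invFact k                                     ∎
  where
  split : invFact (suc k) ≃ (+ 1 / suc k) * invFact k
  split = 1/[m*n]≃1/m*1/n (suc k) (k !) {{_}} {{k !≢0}} {{suc k !≢0}}
  swap : ∀ a b c → a * b * c ≃ b * (a * c)
  swap = solve-∀ ℚᵘ-ring

pochRatio : ℚᵘ → ℕ → ℚᵘ
pochRatio α k = poch α k * invFact k

pochRatio-suc : ∀ α k → pochRatio α (suc k) * ι (suc k) ≃ pochRatio α k * (α + ι k)
pochRatio-suc α k = begin
  poch α k * (α + ι k) * invFact (suc k) * ι (suc k)   ≈⟨ reassoc (poch α k) (α + ι k) _ _ ⟩
  poch α k * (α + ι k) * (invFact (suc k) * ι (suc k)) ≈⟨ *-congˡ {poch α k * (α + ι k)} (invFact-suc k) ⟩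
  poch α k * (α + ι k) * invFact k                     ≈⟨ swap (poch α k) (α + ι k) (invFact k) ⟩
  poch α k * invFact k * (α + ι k)                     ∎
  where
  reassoc : ∀ a b c d → a * b * c * d ≃ a * b * (c * d)
  reassoc = solve-∀ ℚᵘ-ring
  swap : ∀ a b c → a * b * c ≃ a * c * b
  swap = solve-∀ ℚᵘ-ring

pochRatio-suc-/ : ∀ e d k .{{_ : NonZero d}} →
                  pochRatio (+ e / d) (suc k) * ι (suc k) * ι d ≃ pochRatio (+ e / d) k * (ι d * ι k + ι e)
pochRatio-suc-/ e d k = begin
  pochRatio α (suc k) * ι (suc k) * ι d   ≈⟨ *-cong (pochRatio-suc α k) ≃-refl ⟩
  pochRatio α k * (α + ι k) * ι d         ≈⟨ expand (pochRatio α k) α (ι k) (ι d) ⟩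
  pochRatio α k * (ι d * ι k + α * ι d)   ≈⟨ *-congˡ {pochRatio α k} (+-congʳ (ι d * ι k) (e/d*d≃e e d)) ⟩
  pochRatio α k * (ι d * ι k + ι e)       ∎
  where
  α = + e / d
  expand : ∀ P a K D → P * (a + K) * D ≃ P * (D * K + a * D)
  expand = solve-∀ ℚᵘ-ring

pochRatio-split : ∀ α t r →
  pochRatio α (suc (t ℕ.+ r)) * ι (suc (t ℕ.+ r))
    ≃ (α + ι t) * (poch α t * poch (α + ι t + 1ℚᵘ) r) * invFact (t ℕ.+ r)
pochRatio-split α t r = begin
  poch α (suc (t ℕ.+ r)) * invFact (suc q) * ι (suc q)     ≈⟨ *-assoc (poch α (suc q)) _ _ ⟩
  poch α (suc (t ℕ.+ r)) * (invFact (suc q) * ι (suc q))   ≈⟨ *-cong split (invFact-suc q) ⟩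
  poch α t * ((α + ι t) * poch (α + ι t + 1ℚᵘ) r) * invFact q ≈⟨ *-congʳ (swap (poch α t) (α + ι t) _) ⟩
  (α + ι t) * (poch α t * poch (α + ι t + 1ℚᵘ) r) * invFact q ∎
  where
  q = t ℕ.+ r
  split : poch α (suc (t ℕ.+ r)) ≃ poch α t * ((α + ι t) * poch (α + ι t + 1ℚᵘ) r)
  split = begin
    poch α (suc (t ℕ.+ r))               ≡⟨ cong (poch α) (ℕ.+-suc t r) ⟨
    poch α (t ℕ.+ suc r)                 ≈⟨ poch-+ α t (suc r) ⟩
    poch α t * poch (α + ι t) (suc r)    ≈⟨ *-congˡ {poch α t} (poch-suc (α + ι t) r) ⟩
    poch α t * ((α + ι t) * poch (α + ι t + 1ℚᵘ) r) ∎
  swap : ∀ a b c → a * (b * c) ≃ b * (a * c)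
  swap = solve-∀ ℚᵘ-ring

-- Clausen's formula

hypCoeff≃ : ∀ k → hypCoeff k ≃ pochRatio (+ 1 / 6) k * pochRatio (+ 1 / 3) k
hypCoeff≃ k = begin
  P * Q * (+ 1 / (k ! ℕ.* k !)) {{k !* k !≢0}}
    ≈⟨ *-congˡ {P * Q} (1/[m*n]≃1/m*1/n (k !) (k !) {{k !≢0}} {{k !≢0}} {{k !* k !≢0}}) ⟩
  P * Q * (invFact k * invFact k)
    ≈⟨ regroup P Q (invFact k) ⟩
  P * invFact k * (Q * invFact k)
    ∎
  where
  P = poch (+ 1 / 6) k
  Q = poch (+ 1 / 3) k
  regroup : ∀ a b c → a * b * (c * c) ≃ a * c * (b * c)
  regroup = solve-∀ ℚᵘ-ring

clausenCoeff : ℕ → ℚᵘ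
clausenCoeff k = pochRatio (+ 1 / 3) k * pochRatio (+ 2 / 3) k * pochRatio (+ 1 / 2) k

hypNum hypDen clausenNum clausenDen : ℚᵘ → ℚᵘ
hypNum x     = (ι 6 * x + 1ℚᵘ) * (ι 3 * x + 1ℚᵘ)
hypDen x     = ι 18 * ((x + 1ℚᵘ) * (x + 1ℚᵘ))
clausenNum x = (ι 3 * x + 1ℚᵘ) * (ι 3 * x + ι 2) * (ι 2 * x + 1ℚᵘ)
clausenDen x = ι 18 * ((x + 1ℚᵘ) * (x + 1ℚᵘ) * (x + 1ℚᵘ))

hypCoeff-rec : ∀ k → hypCoeff (suc k) * hypDen (ι k) ≃ hypCoeff k * hypNum (ι k)
hypCoeff-rec k = begin
  hypCoeff (suc k) * hypDen (ι k)             ≡⟨ cong (λ s → hypCoeff (suc k) * hypDen′ s) (ι-suc k) ⟨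
  hypCoeff (suc k) * hypDen′ (ι (suc k))      ≈⟨ *-congʳ (hypCoeff≃ (suc k)) ⟩
  A (suc k) * B (suc k) * hypDen′ (ι (suc k)) ≈⟨ split (A (suc k)) (B (suc k)) (ι (suc k)) ⟩
  A (suc k) * ι (suc k) * ι 6 * (B (suc k) * ι (suc k) * ι 3)
                                              ≈⟨ *-cong (pochRatio-suc-/ 1 6 k) (pochRatio-suc-/ 1 3 k) ⟩
  A k * (ι 6 * ι k + 1ℚᵘ) * (B k * (ι 3 * ι k + 1ℚᵘ)) ≈⟨ merge (A k) (B k) _ _ ⟩
  A k * B k * hypNum (ι k)                    ≈⟨ *-congʳ (hypCoeff≃ k) ⟨
  hypCoeff k * hypNum (ι k)                   ∎
  where
  A B : ℕ → ℚᵘ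
  A = pochRatio (+ 1 / 6)
  B = pochRatio (+ 1 / 3)
  hypDen′ : ℚᵘ → ℚᵘ
  hypDen′ s = ι 18 * (s * s)
  split : ∀ a b s → a * b * (ι 18 * (s * s)) ≃ a * s * ι 6 * (b * s * ι 3)
  split = solve-∀ ℚᵘ-ring
  merge : ∀ a b u v → a * u * (b * v) ≃ a * b * (u * v)
  merge = solve-∀ ℚᵘ-ring

clausenCoeff-rec : ∀ k → clausenCoeff (suc k) * clausenDen (ι k) ≃ clausenCoeff k * clausenNum (ι k)
clausenCoeff-rec k = begin
  clausenCoeff (suc k) * clausenDen (ι k)     ≡⟨ cong (λ s → clausenCoeff (suc k) * clausenDen′ s) (ι-suc k) ⟨
  A (suc k) * B (suc k) * C (suc k) * clausenDen′ (ι (suc k))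
                                              ≈⟨ split (A (suc k)) (B (suc k)) (C (suc k)) (ι (suc k)) ⟩
  A (suc k) * ι (suc k) * ι 3 * (B (suc k) * ι (suc k) * ι 3) * (C (suc k) * ι (suc k) * ι 2)
     ≈⟨ *-cong (*-cong (pochRatio-suc-/ 1 3 k) (pochRatio-suc-/ 2 3 k)) (pochRatio-suc-/ 1 2 k) ⟩
  A k * (ι 3 * ι k + 1ℚᵘ) * (B k * (ι 3 * ι k + ι 2)) * (C k * (ι 2 * ι k + 1ℚᵘ))
                                              ≈⟨ merge (A k) (B k) (C k) _ _ _ ⟩
  A k * B k * C k * clausenNum (ι k)          ∎
  where
  A B C : ℕ → ℚᵘ
  A = pochRatio (+ 1 / 3)
  B = pochRatio (+ 2 / 3)
  C = pochRatio (+ 1 / 2)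
  clausenDen′ : ℚᵘ → ℚᵘ
  clausenDen′ s = ι 18 * (s * s * s)
  split : ∀ a b c s → a * b * c * (ι 18 * (s * s * s)) ≃ a * s * ι 3 * (b * s * ι 3) * (c * s * ι 2)
  split = solve-∀ ℚᵘ-ring
  merge : ∀ a b c u v w → a * u * (b * v) * (c * w) ≃ a * b * c * (u * v * w)
  merge = solve-∀ ℚᵘ-ring

-- The rational factor of Zeilberger's certificate for the recurrence of Σⱼ hⱼ hₙ₋ⱼ.
certWeight : ℚᵘ → ℚᵘ → ℚᵘ
certWeight N J = ι 18 * (J * J) * (ι 3 * N + ι 3 - ι 2 * J)

clausenDen-split : ∀ J M → clausenDen (J + M) ≃ hypDen M * (ι 3 * J + M + 1ℚᵘ) + certWeight (J + M) J
clausenDen-split = identity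
  where
  identity : ∀ J M → ι 18 * ((J + M + 1ℚᵘ) * (J + M + 1ℚᵘ) * (J + M + 1ℚᵘ))
                     ≃ ι 18 * ((M + 1ℚᵘ) * (M + 1ℚᵘ)) * (ι 3 * J + M + 1ℚᵘ)
                       + ι 18 * (J * J) * (ι 3 * (J + M) + ι 3 - ι 2 * J)
  identity = solve-∀ ℚᵘ-ring

clausenNum-split : ∀ J M → clausenNum (J + M) ≃ hypNum M * (ι 3 * J + M + 1ℚᵘ) + hypNum J * (J + ι 3 * M + 1ℚᵘ)
clausenNum-split = identity
  where
  identity : ∀ J M → (ι 3 * (J + M) + 1ℚᵘ) * (ι 3 * (J + M) + ι 2) * (ι 2 * (J + M) + 1ℚᵘ)
                     ≃ (ι 6 * M + 1ℚᵘ) * (ι 3 * M + 1ℚᵘ) * (ι 3 * J + M + 1ℚᵘ)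
                       + (ι 6 * J + 1ℚᵘ) * (ι 3 * J + 1ℚᵘ) * (J + ι 3 * M + 1ℚᵘ)
  identity = solve-∀ ℚᵘ-ring

certWeight-suc : ∀ J M → certWeight (J + M) (J + 1ℚᵘ) ≃ hypDen J * (J + ι 3 * M + 1ℚᵘ)
certWeight-suc = identity
  where
  identity : ∀ J M → ι 18 * ((J + 1ℚᵘ) * (J + 1ℚᵘ)) * (ι 3 * (J + M) + ι 3 - ι 2 * (J + 1ℚᵘ))
                     ≃ ι 18 * ((J + 1ℚᵘ) * (J + 1ℚᵘ)) * (J + ι 3 * M + 1ℚᵘ)
  identity = solve-∀ ℚᵘ-ring

certificate-identity : ∀ a a′ b b′ J M → a′ * hypDen J ≃ a * hypNum J → b′ * hypDen M ≃ b * hypNum M →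
  clausenDen (J + M) * (a * b′) + certWeight (J + M) (J + 1ℚᵘ) * (a′ * b)
    ≃ clausenNum (J + M) * (a * b) + certWeight (J + M) J * (a * b′)
certificate-identity a a′ b b′ J M recJ recM = begin
  clausenDen (J + M) * (a * b′) + certWeight (J + M) (J + 1ℚᵘ) * (a′ * b)
    ≈⟨ +-cong (*-congʳ (clausenDen-split J M)) (*-congʳ (certWeight-suc J M)) ⟩
  (hypDen M * u + W) * (a * b′) + hypDen J * v * (a′ * b)
    ≈⟨ regroup₁ a a′ b b′ (hypDen M) (hypDen J) u v W ⟩
  a * (b′ * hypDen M) * u + W * (a * b′) + a′ * hypDen J * v * b
    ≈⟨ +-cong (+-cong (*-congʳ (*-congˡ {a} recM)) ≃-refl) (*-congʳ (*-congʳ recJ)) ⟩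
  a * (b * hypNum M) * u + W * (a * b′) + a * hypNum J * v * b
    ≈⟨ regroup₂ a b b′ (hypNum M) (hypNum J) u v W ⟩
  (hypNum M * u + hypNum J * v) * (a * b) + W * (a * b′)
    ≈⟨ +-congˡ (W * (a * b′)) (*-congʳ (clausenNum-split J M)) ⟨
  clausenNum (J + M) * (a * b) + W * (a * b′)
    ∎
  where
  u = ι 3 * J + M + 1ℚᵘ
  v = J + ι 3 * M + 1ℚᵘ
  W = certWeight (J + M) J
  regroup₁ : ∀ a a′ b b′ DM DJ u v W →
             (DM * u + W) * (a * b′) + DJ * v * (a′ * b) ≃ a * (b′ * DM) * u + W * (a * b′) + a′ * DJ * v * b
  regroup₁ = solve-∀ ℚᵘ-ring
  regroup₂ : ∀ a b b′ NM NJ u v W →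
             a * (b * NM) * u + W * (a * b′) + a * NJ * v * b ≃ (NM * u + NJ * v) * (a * b) + W * (a * b′)
  regroup₂ = solve-∀ ℚᵘ-ring

convolution : ℕ → ℚᵘ
convolution n = sumTo n (λ j → hypCoeff j * hypCoeff (n ∸ j))

certificate : ℕ → ℕ → ℚᵘ
certificate n j = certWeight (ι n) (ι j) * (hypCoeff j * hypCoeff (suc n ∸ j))

certificate-step : ∀ j m →
  clausenDen (ι (j ℕ.+ m)) * (hypCoeff j * hypCoeff (suc (j ℕ.+ m) ∸ j)) + certificate (j ℕ.+ m) (suc j)
    ≃ clausenNum (ι (j ℕ.+ m)) * (hypCoeff j * hypCoeff (j ℕ.+ m ∸ j)) + certificate (j ℕ.+ m) j
certificate-step j m =
  generalised (ι-+ j m) (ι-suc j) (ℕ.+-∸-assoc 1 (ℕ.m≤m+n j m)) (ℕ.m+n∸m≡n j m)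
  where
  h = hypCoeff
  generalised : ∀ {N S i k} → N ≡ ι j + ι m → S ≡ ι j + 1ℚᵘ → i ≡ suc k → k ≡ m →
    clausenDen N * (h j * h i) + certWeight N S * (h (suc j) * h k)
      ≃ clausenNum N * (h j * h k) + certWeight N (ι j) * (h j * h i)
  generalised refl refl refl refl =
    certificate-identity (h j) (h (suc j)) (h m) (h (suc m)) (ι j) (ι m) (hypCoeff-rec j) (hypCoeff-rec m)

convolution-rec : ∀ n → convolution (suc n) * clausenDen (ι n) ≃ convolution n * clausenNum (ι n)
convolution-rec n = begin
  convolution (suc n) * den                              ≈⟨ *-comm (convolution (suc n)) den ⟩
  den * (sumTo n next + h (suc n) * h (suc n ∸ suc n))   ≈⟨ *-distribˡ-+ den (sumTo n next) _ ⟩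
  den * sumTo n next + den * (h (suc n) * h (n ∸ n))     ≈⟨ +-cong (*-distribˡ-sumTo n den next) last-term ⟩
  sumTo n f + certificate n (suc n)                      ≈⟨ sumTo-telescope n f g (certificate n) step ⟩
  sumTo n g + certificate n 0                            ≈⟨ +-congʳ (sumTo n g) first-term ⟩
  sumTo n g + 0ℚᵘ                                        ≈⟨ +-identityʳ (sumTo n g) ⟩
  sumTo n g                                              ≈⟨ *-distribˡ-sumTo n num this ⟨
  num * convolution n                                    ≈⟨ *-comm num (convolution n) ⟩
  convolution n * num                                    ∎
  where
  h = hypCoeff
  den = clausenDen (ι n)
  num = clausenNum (ι n)
  next this f g : ℕ → ℚᵘ
  next j = h j * h (suc n ∸ j)
  this j = h j * h (n ∸ j)
  f j = den * next j
  g j = num * this j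
  step : ∀ j → j ≤ n → f j + certificate n (suc j) ≃ g j + certificate n j
  step j j≤n with ℕ.m≤n⇒∃[o]m+o≡n j≤n
  ... | m , refl = certificate-step j m
  last-term : den * (h (suc n) * h (n ∸ n)) ≃ certificate n (suc n)
  last-term = ≃-trans (*-congʳ {h (suc n) * h (n ∸ n)} (top (ι n)))
                      (≃-reflexive (cong (λ S → certWeight (ι n) S * (h (suc n) * h (n ∸ n))) (sym (ι-suc n))))
    where
    top : ∀ N → ι 18 * ((N + 1ℚᵘ) * (N + 1ℚᵘ) * (N + 1ℚᵘ))
                ≃ ι 18 * ((N + 1ℚᵘ) * (N + 1ℚᵘ)) * (ι 3 * N + ι 3 - ι 2 * (N + 1ℚᵘ))
    top = solve-∀ ℚᵘ-ring
  first-term : certificate n 0 ≃ 0ℚᵘ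
  first-term = vanish (ι 3 * ι n + ι 3 - ι 2 * ι 0) (h 0 * h (suc n))
    where
    vanish : ∀ w x → ι 18 * (ι 0 * ι 0) * w * x ≃ 0ℚᵘ
    vanish = solve-∀ ℚᵘ-ring

clausenDen-ι : ∀ n → ι (18 ℕ.* (suc n ℕ.* suc n ℕ.* suc n)) ≡ clausenDen (ι n)
clausenDen-ι n = trans (ι-* 18 (S ℕ.* S ℕ.* S))
  (cong (ι 18 *_) (trans (ι-* (S ℕ.* S) S) (trans (cong (_* ι S) (ι-* S S)) (cong (λ x → x * x * x) (ι-suc n)))))
  where S = suc n

clausen : ∀ n → convolution n ≃ clausenCoeff n
clausen zero    = *≡* refl
clausen (suc n) = *-cancelʳ-ι (18 ℕ.* (suc n ℕ.* suc n ℕ.* suc n)) (begin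
  convolution (suc n) * ι _        ≡⟨ cong (convolution (suc n) *_) (clausenDen-ι n) ⟩
  convolution (suc n) * clausenDen (ι n)   ≈⟨ convolution-rec n ⟩
  convolution n * clausenNum (ι n)         ≈⟨ *-congʳ (clausen n) ⟩
  clausenCoeff n * clausenNum (ι n)        ≈⟨ clausenCoeff-rec n ⟨
  clausenCoeff (suc n) * clausenDen (ι n)  ≡⟨ cong (clausenCoeff (suc n) *_) (clausenDen-ι n) ⟨
  clausenCoeff (suc n) * ι _       ∎)

cubeCoeff≃ : ∀ n → cubeCoeff n ≃ sumTo n (λ i → hypCoeff i * clausenCoeff (n ∸ i))
cubeCoeff≃ n = sumTo-cong n λ i → begin
  sumTo (n ∸ i) (λ j → h i * h j * h (n ∸ i ∸ j))     ≈⟨ sumTo-cong (n ∸ i) (λ j → *-assoc (h i) (h j) _) ⟩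
  sumTo (n ∸ i) (λ j → h i * (h j * h (n ∸ i ∸ j)))   ≈⟨ *-distribˡ-sumTo (n ∸ i) (h i) _ ⟨
  h i * convolution (n ∸ i)                            ≈⟨ *-congˡ {h i} (clausen (n ∸ i)) ⟩
  h i * clausenCoeff (n ∸ i)                           ∎
  where h = hypCoeff

module Congruences {p : ℕ} (p-prime : Prime p) where

  infix 4 _∣ₚ_

  -- m ∣ₚ x says x ∈ m·ℤ₍ₚ₎; in particular x ≡ᵘ y [mod p ] is p ∣ₚ (x - y).
  record _∣ₚ_ (m : ℕ) (x : ℚᵘ) : Set where
    constructor witness
    field
      numerator denominator : ℤ
      p∤denominator : ¬ (+ p ℤ.∣ denominator)
      scaled : denominator / 1 * x ≃ + m / 1 * (numerator / 1)

  Integral : ℚᵘ → Set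
  Integral x = 1 ∣ₚ x

  ∤-* : ∀ {m n} → ¬ (p ℕ.∣ m) → ¬ (p ℕ.∣ n) → ¬ (p ℕ.∣ m ℕ.* n)
  ∤-* {m} {n} p∤m p∤n p∣mn with euclidsLemma m n p-prime p∣mn
  ... | inj₁ p∣m = p∤m p∣m
  ... | inj₂ p∣n = p∤n p∣n

  ∤-*ℤ : ∀ {b c} → ¬ (+ p ℤ.∣ b) → ¬ (+ p ℤ.∣ c) → ¬ (+ p ℤ.∣ b ℤ.* c)
  ∤-*ℤ {b} {c} p∤b p∤c = ∤-* p∤b p∤c ∘′ subst (p ℕ.∣_) (ℤ.abs-* b c)

  1<p : 1 < p
  1<p = ℕ.nonTrivial⇒n>1 p {{prime⇒nonTrivial p-prime}}

  ∤-small : ∀ {d} → 0 < d → d < p → ¬ (p ℕ.∣ d)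
  ∤-small {suc d} _ d<p p∣d = ℕ.<⇒≱ d<p (ℕ.∣⇒≤ p∣d)

  ∤! : ∀ {k} → k < p → ¬ (p ℕ.∣ k !)
  ∤! {zero}  _   = ∤-small ℕ.z<s 1<p
  ∤! {suc k} k<p = ∤-* (∤-small ℕ.z<s k<p) (∤! (ℕ.<-trans (ℕ.n<1+n k) k<p))

  ∣ₚ-resp-≃ : ∀ {m x y} → x ≃ y → m ∣ₚ x → m ∣ₚ y
  ∣ₚ-resp-≃ x≃y (witness a b p∤b eq) = witness a b p∤b (≃-trans (*-congˡ {b / 1} (≃-sym x≃y)) eq)

  ∣ₚ-0 : ∀ {m} → m ∣ₚ 0ℚᵘ
  ∣ₚ-0 {m} = witness (+ 0) (+ 1) (∤-small ℕ.z<s 1<p) (zeros (+ m / 1))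
    where
    zeros : ∀ M → 1ℚᵘ * 0ℚᵘ ≃ M * 0ℚᵘ
    zeros = solve-∀ ℚᵘ-ring

  ∣ₚ-+ : ∀ {m x y} → m ∣ₚ x → m ∣ₚ y → m ∣ₚ (x + y)
  ∣ₚ-+ {m} {x} {y} (witness a b p∤b eqx) (witness a′ b′ p∤b′ eqy) =
    witness (a ℤ.* b′ ℤ.+ a′ ℤ.* b) (b ℤ.* b′) (∤-*ℤ {b} {b′} p∤b p∤b′) (begin
      B * B′ * (x + y)              ≈⟨ distribute B B′ x y ⟩
      B′ * (B * x) + B * (B′ * y)   ≈⟨ +-cong (*-congˡ {B′} eqx) (*-congˡ {B} eqy) ⟩
      B′ * (M * A) + B * (M * A′)   ≈⟨ collect B B′ M A A′ ⟩
      M * (A * B′ + A′ * B)         ≡⟨ cong (M *_) (/1-homo-+ (a ℤ.* b′) (a′ ℤ.* b)) ⟨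
      M * ((a ℤ.* b′ ℤ.+ a′ ℤ.* b) / 1) ∎)
    where
    A = a / 1
    A′ = a′ / 1
    B = b / 1
    B′ = b′ / 1
    M = + m / 1
    distribute : ∀ B B′ x y → B * B′ * (x + y) ≃ B′ * (B * x) + B * (B′ * y)
    distribute = solve-∀ ℚᵘ-ring
    collect : ∀ B B′ M A A′ → B′ * (M * A) + B * (M * A′) ≃ M * (A * B′ + A′ * B)
    collect = solve-∀ ℚᵘ-ring

  ∣ₚ-neg : ∀ {m x} → m ∣ₚ x → m ∣ₚ (- x)
  ∣ₚ-neg {m} {x} (witness a b p∤b eq) = witness (ℤ.- a) b p∤b (begin
    b / 1 * (- x)         ≈⟨ neg-out (b / 1) x ⟩
    - (b / 1 * x)         ≈⟨ -‿cong eq ⟩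
    - (+ m / 1 * (a / 1)) ≈⟨ neg-in (+ m / 1) (a / 1) ⟩
    + m / 1 * - (a / 1)   ∎)
    where
    neg-out : ∀ B x → B * (- x) ≃ - (B * x)
    neg-out = solve-∀ ℚᵘ-ring
    neg-in : ∀ M A → - (M * A) ≃ M * (- A)
    neg-in = solve-∀ ℚᵘ-ring

  ∣ₚ-*ʳ : ∀ {m x y} → m ∣ₚ x → Integral y → m ∣ₚ (x * y)
  ∣ₚ-*ʳ {m} {x} {y} (witness a b p∤b eqx) (witness a′ b′ p∤b′ eqy) =
    witness (a ℤ.* a′) (b ℤ.* b′) (∤-*ℤ {b} {b′} p∤b p∤b′) (begin
      b / 1 * (b′ / 1) * (x * y)       ≈⟨ interchange (b / 1) (b′ / 1) x y ⟩
      b / 1 * x * (b′ / 1 * y)         ≈⟨ *-cong eqx eqy ⟩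
      + m / 1 * (a / 1) * (1ℚᵘ * (a′ / 1))  ≈⟨ drop-1 (+ m / 1) (a / 1) (a′ / 1) ⟩
      + m / 1 * (a / 1 * (a′ / 1))     ∎)
    where
    interchange : ∀ B B′ x y → B * B′ * (x * y) ≃ B * x * (B′ * y)
    interchange = solve-∀ ℚᵘ-ring
    drop-1 : ∀ M A A′ → M * A * (1ℚᵘ * A′) ≃ M * (A * A′)
    drop-1 = solve-∀ ℚᵘ-ring

  ∣ₚ-*ˡ : ∀ {m x y} → Integral x → m ∣ₚ y → m ∣ₚ (x * y)
  ∣ₚ-*ˡ {x = x} {y} x-int m∣y = ∣ₚ-resp-≃ (*-comm y x) (∣ₚ-*ʳ m∣y x-int)

  ∣ₚ⇒Integral : ∀ {m x} → m ∣ₚ x → Integral x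
  ∣ₚ⇒Integral {m} (witness a b p∤b eq) = witness (+ m ℤ.* a) b p∤b (≃-trans eq (≃-sym (*-identityˡ _)))

  ∣ₚ-ι* : ∀ {m y} → Integral y → m ∣ₚ (ι m * y)
  ∣ₚ-ι* {m} {y} (witness a b p∤b eq) = witness a b p∤b (begin
    b / 1 * (ι m * y)     ≈⟨ swap (b / 1) (ι m) y ⟩
    ι m * (b / 1 * y)     ≈⟨ *-congˡ {ι m} eq ⟩
    ι m * (1ℚᵘ * (a / 1)) ≈⟨ *-congˡ {ι m} (*-identityˡ (a / 1)) ⟩
    ι m * (a / 1)         ∎)
    where
    swap : ∀ B M y → B * (M * y) ≃ M * (B * y)
    swap = solve-∀ ℚᵘ-ring

  Integral-/ : ∀ n d .{{_ : NonZero d}} → ¬ (p ℕ.∣ d) → Integral (+ n / d)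
  Integral-/ n d p∤d = witness (+ n) (+ d) p∤d
    (≃-trans (*-comm (ι d) (+ n / d)) (≃-trans (e/d*d≃e n d) (≃-sym (*-identityˡ (ι n)))))

  Integral-ι : ∀ n → Integral (ι n)
  Integral-ι n = Integral-/ n 1 (∤-small ℕ.z<s 1<p)

  ∣ₚ-ι⇒∣ : ∀ {n} → p ∣ₚ ι n → p ℕ.∣ n
  ∣ₚ-ι⇒∣ {n} (witness a b p∤b eq) with euclidsLemma ℤ.∣ b ∣ n p-prime p∣bn
    where
    b*n≡p*a : b ℤ.* + n ≡ + p ℤ.* a
    b*n≡p*a = trans (sym (ℤ.*-identityʳ _)) (trans (drop-*≡* eq) (ℤ.*-identityʳ _))
    p∣bn : p ℕ.∣ ℤ.∣ b ∣ ℕ.* n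
    p∣bn = divides ℤ.∣ a ∣ (trans (sym (ℤ.abs-* b (+ n))) (trans (cong ℤ.∣_∣ b*n≡p*a)
                                   (trans (ℤ.abs-* (+ p) a) (ℕ.*-comm p ℤ.∣ a ∣))))
  ... | inj₁ p∣b = contradiction p∣b p∤b
  ... | inj₂ p∣n = p∣n

  infix 4 _≡ₚ_

  record _≡ₚ_ (x y : ℚᵘ) : Set where
    constructor mod-p
    field p∣difference : p ∣ₚ (x - y)

  ≃⇒≡ₚ : ∀ {x y} → x ≃ y → x ≡ₚ y
  ≃⇒≡ₚ {x} {y} x≃y = mod-p (∣ₚ-resp-≃ (≃-sym (≃-trans (+-congˡ (- y) x≃y) (+-inverseʳ y))) ∣ₚ-0)

  ≡ₚ-refl : ∀ {x} → x ≡ₚ x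
  ≡ₚ-refl = ≃⇒≡ₚ ≃-refl

  ≡ₚ-sym : ∀ {x y} → x ≡ₚ y → y ≡ₚ x
  ≡ₚ-sym {x} {y} (mod-p d) = mod-p (∣ₚ-resp-≃ (flip x y) (∣ₚ-neg d))
    where
    flip : ∀ x y → - (x - y) ≃ y - x
    flip = solve-∀ ℚᵘ-ring

  ≡ₚ-trans : ∀ {x y z} → x ≡ₚ y → y ≡ₚ z → x ≡ₚ z
  ≡ₚ-trans {x} {y} {z} (mod-p d) (mod-p e) = mod-p (∣ₚ-resp-≃ (+-minus-telescope x y z) (∣ₚ-+ d e))

  ≡ₚ-+ : ∀ {x x′ y y′} → x ≡ₚ x′ → y ≡ₚ y′ → x + y ≡ₚ x′ + y′
  ≡ₚ-+ {x} {x′} {y} {y′} (mod-p d) (mod-p e) = mod-p (∣ₚ-resp-≃ (regroup x x′ y y′) (∣ₚ-+ d e))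
    where
    regroup : ∀ x x′ y y′ → (x - x′) + (y - y′) ≃ (x + y) - (x′ + y′)
    regroup = solve-∀ ℚᵘ-ring

  ≡ₚ-Integral : ∀ {x y} → x ≡ₚ y → Integral y → Integral x
  ≡ₚ-Integral {x} {y} (mod-p d) y-int = ∣ₚ-resp-≃ (restore x y) (∣ₚ-+ (∣ₚ⇒Integral d) y-int)
    where
    restore : ∀ x y → (x - y) + y ≃ x
    restore = solve-∀ ℚᵘ-ring

  ≡ₚ-* : ∀ {x x′ y y′} → x ≡ₚ x′ → y ≡ₚ y′ → Integral x → Integral y′ → x * y ≡ₚ x′ * y′
  ≡ₚ-* {x} {x′} {y} {y′} (mod-p d) (mod-p e) x-int y′-int =
    mod-p (∣ₚ-resp-≃ (regroup x x′ y y′) (∣ₚ-+ (∣ₚ-*ˡ x-int e) (∣ₚ-*ʳ d y′-int)))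
    where
    regroup : ∀ x x′ y y′ → x * (y - y′) + (x - x′) * y′ ≃ x * y - x′ * y′
    regroup = solve-∀ ℚᵘ-ring

  ∣ₚ⇒≡ₚ0 : ∀ {x} → p ∣ₚ x → x ≡ₚ 0ℚᵘ
  ∣ₚ⇒≡ₚ0 {x} d = mod-p (∣ₚ-resp-≃ (minus-0 x) d)
    where
    minus-0 : ∀ x → x ≃ x - 0ℚᵘ
    minus-0 = solve-∀ ℚᵘ-ring

  ≡ₚ0⇒∣ₚ : ∀ {x} → x ≡ₚ 0ℚᵘ → p ∣ₚ x
  ≡ₚ0⇒∣ₚ {x} (mod-p d) = ∣ₚ-resp-≃ (minus-0 x) d
    where
    minus-0 : ∀ x → x - 0ℚᵘ ≃ x
    minus-0 = solve-∀ ℚᵘ-ring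

  sumTo-≡ₚ-head : ∀ n (f : ℕ → ℚᵘ) → (∀ i → 0 < i → i ≤ n → p ∣ₚ f i) → sumTo n f ≡ₚ f 0
  sumTo-≡ₚ-head zero    f _      = ≡ₚ-refl
  sumTo-≡ₚ-head (suc n) f vanish =
    ≡ₚ-trans (≡ₚ-+ (sumTo-≡ₚ-head n f (λ i 0<i i≤n → vanish i 0<i (ℕ.m≤n⇒m≤1+n i≤n)))
                   (∣ₚ⇒≡ₚ0 (vanish (suc n) ℕ.z<s ℕ.≤-refl)))
             (≃⇒≡ₚ (+-identityʳ (f 0)))

  poch-Integral : ∀ {α} k → Integral α → Integral (poch α k)
  poch-Integral zero    _     = Integral-ι 1
  poch-Integral (suc k) α-int = ∣ₚ-*ʳ (poch-Integral k α-int) (∣ₚ-+ α-int (Integral-ι k))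

  invFact-Integral : ∀ {k} → k < p → Integral (invFact k)
  invFact-Integral {k} k<p = Integral-/ 1 (k !) {{k !≢0}} (∤! k<p)

  pochRatio-Integral : ∀ {α k} → Integral α → k < p → Integral (pochRatio α k)
  pochRatio-Integral {k = k} α-int k<p = ∣ₚ-*ʳ (poch-Integral k α-int) (invFact-Integral k<p)

  poch-≡ₚ : ∀ {α β} k → α ≡ₚ β → Integral β → poch α k ≡ₚ poch β k
  poch-≡ₚ zero    _     _     = ≡ₚ-refl
  poch-≡ₚ (suc k) α≡β β-int =
    ≡ₚ-* (poch-≡ₚ k α≡β β-int) (≡ₚ-+ α≡β ≡ₚ-refl)
         (poch-Integral k (≡ₚ-Integral α≡β β-int)) (∣ₚ-+ β-int (Integral-ι k))

  poch-vanishes : ∀ {α t} k → Integral α → p ∣ₚ (α + ι t) → t < k → p ∣ₚ poch α k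
  poch-vanishes (suc k) α-int p∣α+t t<1+k with ℕ.m<1+n⇒m<n∨m≡n t<1+k
  ... | inj₁ t<k  = ∣ₚ-*ʳ (poch-vanishes k α-int p∣α+t t<k) (∣ₚ-+ α-int (Integral-ι k))
  ... | inj₂ refl = ∣ₚ-*ˡ (poch-Integral k α-int) p∣α+t

  shift-∣ₚ : ∀ {α γ} t → Integral γ → α + ι t ≃ ι p * γ → p ∣ₚ (α + ι t)
  shift-∣ₚ t γ-int α+t≃pγ = ∣ₚ-resp-≃ (≃-sym α+t≃pγ) (∣ₚ-ι* γ-int)

  shift-Integral : ∀ {α γ} t → Integral γ → α + ι t ≃ ι p * γ → Integral α
  shift-Integral {α} t γ-int α+t≃pγ =
    ∣ₚ-resp-≃ (cancel α (ι t))
              (∣ₚ-+ (∣ₚ⇒Integral (shift-∣ₚ {α} t γ-int α+t≃pγ)) (∣ₚ-neg (Integral-ι t)))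
    where
    cancel : ∀ a T → a + T + - T ≃ a
    cancel = solve-∀ ℚᵘ-ring

  pochRatio-vanishes : ∀ {α γ k} t → Integral γ → α + ι t ≃ ι p * γ → t < k → k < p →
                       p ∣ₚ pochRatio α k
  pochRatio-vanishes {α} {k = k} t γ-int α+t≃pγ t<k k<p =
    ∣ₚ-*ʳ (poch-vanishes k (shift-Integral t γ-int α+t≃pγ) (shift-∣ₚ {α} t γ-int α+t≃pγ) t<k)
          (invFact-Integral k<p)

  pochRatio-at-p : ∀ {α γ} t → t < p → Integral γ → α + ι t ≃ ι p * γ → pochRatio α p ≡ₚ γ
  pochRatio-at-p {α} {γ} t t<p γ-int α+t≃pγ with ℕ.m≤n⇒∃[o]m+o≡n t<p
  ... | r , 1+t+r≡p = ≡ₚ-trans (≃⇒≡ₚ factor) (≡ₚ-trans reduce (≃⇒≡ₚ cancel))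
    where
    q = t ℕ.+ r
    X = poch α t * poch (α + ι t + 1ℚᵘ) r

    factor : pochRatio α p ≃ γ * X * invFact q
    factor = *-cancelʳ-ι p {{prime⇒nonZero p-prime}} (begin
      pochRatio α p * ι p              ≡⟨ cong (λ n → pochRatio α n * ι n) (sym 1+t+r≡p) ⟩
      pochRatio α (suc q) * ι (suc q)  ≈⟨ pochRatio-split α t r ⟩
      (α + ι t) * X * invFact q        ≈⟨ *-congʳ (*-congʳ α+t≃pγ) ⟩
      ι p * γ * X * invFact q          ≈⟨ move (ι p) γ X (invFact q) ⟩
      γ * X * invFact q * ι p          ∎)
      where
      move : ∀ P g x f → P * g * x * f ≃ g * x * f * P
      move = solve-∀ ℚᵘ-ring

    α≡1+r : α ≡ₚ ι (suc r)
    α≡1+r = mod-p (∣ₚ-resp-≃ difference (∣ₚ-ι* (∣ₚ-+ γ-int (∣ₚ-neg (Integral-ι 1)))))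
      where
      ιp≡ : ι p ≡ ι t + ι (suc r)
      ιp≡ = trans (cong ι (trans (sym 1+t+r≡p) (sym (ℕ.+-suc t r)))) (ι-+ t (suc r))
      expand : ∀ P g → P * (g - 1ℚᵘ) ≃ P * g - P
      expand = solve-∀ ℚᵘ-ring
      cancel-t : ∀ a T S → (a + T) - (T + S) ≃ a - S
      cancel-t = solve-∀ ℚᵘ-ring
      difference : ι p * (γ - 1ℚᵘ) ≃ α - ι (suc r)
      difference = begin
        ι p * (γ - 1ℚᵘ)                ≈⟨ expand (ι p) γ ⟩
        ι p * γ - ι p                  ≈⟨ +-cong (≃-sym α+t≃pγ) (-‿cong (≃-reflexive ιp≡)) ⟩
        (α + ι t) - (ι t + ι (suc r))  ≈⟨ cancel-t α (ι t) (ι (suc r)) ⟩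
        α - ι (suc r)                  ∎

    shifted≡1 : α + ι t + 1ℚᵘ ≡ₚ 1ℚᵘ
    shifted≡1 = mod-p (∣ₚ-resp-≃ (add-sub (α + ι t)) (shift-∣ₚ {α} t γ-int α+t≃pγ))
      where
      add-sub : ∀ x → x ≃ x + 1ℚᵘ - 1ℚᵘ
      add-sub = solve-∀ ℚᵘ-ring

    X≡q! : X ≡ₚ ι (q !)
    X≡q! = ≡ₚ-trans
      (≡ₚ-* (poch-≡ₚ t α≡1+r (Integral-ι (suc r))) (poch-≡ₚ r shifted≡1 (Integral-ι 1))
            (poch-Integral t (shift-Integral t γ-int α+t≃pγ)) (poch-Integral r (Integral-ι 1)))
      (≃⇒≡ₚ (begin
        poch (ι (suc r)) t * poch 1ℚᵘ r          ≈⟨ *-comm (poch (ι (suc r)) t) _ ⟩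
        poch 1ℚᵘ r * poch (ι (suc r)) t          ≡⟨ cong (λ x → poch 1ℚᵘ r * poch x t) (ι-+ 1 r) ⟩
        poch 1ℚᵘ r * poch (1ℚᵘ + ι r) t          ≈⟨ poch-+ 1ℚᵘ r t ⟨
        poch 1ℚᵘ (r ℕ.+ t)                       ≈⟨ poch-1 (r ℕ.+ t) ⟩
        ι ((r ℕ.+ t) !)                          ≡⟨ cong (λ n → ι (n !)) (ℕ.+-comm r t) ⟩
        ι (q !)                                  ∎))

    reduce : γ * X * invFact q ≡ₚ γ * ι (q !) * invFact q
    reduce = ≡ₚ-* (≡ₚ-* ≡ₚ-refl X≡q! γ-int (Integral-ι (q !))) ≡ₚ-refl
                  (∣ₚ-*ʳ γ-int (≡ₚ-Integral X≡q! (Integral-ι (q !))))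
                  (invFact-Integral (subst (q <_) 1+t+r≡p (ℕ.n<1+n q)))

    cancel : γ * ι (q !) * invFact q ≃ γ
    cancel = ≃-trans (*-assoc γ _ _) (≃-trans (*-congˡ {γ} (ι!*invFact q)) (*-identityʳ γ))

  ≡ₚ⇒≡ᵘ : ∀ {x y} → x ≡ₚ y → x ≡ᵘ y [mod p ]
  ≡ₚ⇒≡ᵘ (mod-p (witness a b p∤b eq)) = a , b , p∤b , eq

  ≡ᵘ⇒≡ₚ : ∀ {x y} → x ≡ᵘ y [mod p ] → x ≡ₚ y
  ≡ᵘ⇒≡ₚ (a , b , p∤b , eq) = mod-p (witness a b p∤b eq)

  ^-Integral : ∀ {x} n → Integral x → Integral (x ^ᵘ n)
  ^-Integral zero    _     = Integral-ι 1
  ^-Integral (suc n) x-int = ∣ₚ-*ˡ x-int (^-Integral n x-int)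

  ∣⇒∣ₚ-× : ∀ {n z} → p ℕ.∣ n → Integral z → p ∣ₚ n ×ᵘ z
  ∣⇒∣ₚ-× {n} {z} (divides c refl) z-int =
    ∣ₚ-resp-≃ (≃-trans (shuffle (ι p) (ι c) z)
                       (≃-sym (≃-trans (×≃ι* (c ℕ.* p) z) (*-congʳ {z} (≃-reflexive (ι-* c p))))))
              (∣ₚ-ι* (∣ₚ-*ˡ (Integral-ι c) z-int))
    where
    shuffle : ∀ P C z → P * (C * z) ≃ C * P * z
    shuffle = solve-∀ ℚᵘ-ring

  p∣p! : p ℕ.∣ p !
  p∣p! = subst (λ n → n ℕ.∣ n !) (ℕ.suc-pred p {{prime⇒nonZero p-prime}}) (ℕ.m∣m*n _)

  p∣pCk : ∀ {k} → 0 < k → k < p → p ℕ.∣ p C k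
  p∣pCk {k} 0<k k<p with euclidsLemma (k ! ℕ.* (p ∸ k) !) (p C k) p-prime (subst (p ℕ.∣_) p!≡ p∣p!)
    where
    p!≡ : p ! ≡ k ! ℕ.* (p ∸ k) ! ℕ.* (p C k)
    p!≡ = sym (trans (cong (k ! ℕ.* (p ∸ k) ! ℕ.*_) (nCk≡n!/k![n-k]! (ℕ.<⇒≤ k<p)))
                     (m*[n/m]≡n {{k !* (p ∸ k) !≢0}} (k![n∸k]!∣n! (ℕ.<⇒≤ k<p))))
  ... | inj₁ p∣k![p-k]! =
    contradiction p∣k![p-k]! (∤-* (∤! k<p) (∤! (ℕ.∸-monoʳ-< {p} {k} {0} 0<k (ℕ.<⇒≤ k<p))))
  ... | inj₂ p∣pCk = p∣pCk

  sum-∣ₚ : ∀ {n} (v : Vector ℚᵘ n) → (∀ i → p ∣ₚ v i) → p ∣ₚ sum v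
  sum-∣ₚ {zero}  v _         = ∣ₚ-0
  sum-∣ₚ {suc n} v p∣entries = ∣ₚ-+ (p∣entries Fin.zero) (sum-∣ₚ (v ∘ Fin.suc) (p∣entries ∘ Fin.suc))

  frobenius : ∀ {x} → Integral x → (x + 1ℚᵘ) ^ᵘ p ≡ₚ x ^ᵘ p + 1ℚᵘ
  frobenius {x} x-int = subst (λ n → (x + 1ℚᵘ) ^ᵘ n ≡ₚ x ^ᵘ n + 1ℚᵘ) 1+q≡p
    (≡ₚ-trans (≃⇒≡ₚ expansion)
    (≡ₚ-trans (≡ₚ-+ (≃⇒≡ₚ first) (≡ₚ-+ (∣ₚ⇒≡ₚ0 (sum-∣ₚ _ middle)) (≃⇒≡ₚ final)))
              (≃⇒≡ₚ (rearrange (x ^ᵘ n)))))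
    where
    q = ℕ.pred p
    1+q≡p : suc q ≡ p
    1+q≡p = ℕ.suc-pred p {{prime⇒nonZero p-prime}}
    n = suc q
    f : ℕ → ℚᵘ
    f k = (n C k) ×ᵘ (x ^ k * 1ℚᵘ ^ (n ∸ k))
    term : Fin (suc n) → ℚᵘ
    term k = f (toℕ k)
    expansion : (x + 1ℚᵘ) ^ᵘ n ≃ term Fin.zero + (sum (init (term ∘ Fin.suc)) + last (term ∘ Fin.suc))
    expansion = begin
      (x + 1ℚᵘ) ^ᵘ n                       ≡⟨ ^≡^ᵘ (x + 1ℚᵘ) n ⟨
      (x + 1ℚᵘ) ^ n                        ≈⟨ binomial-theorem n x 1ℚᵘ ⟩
      term Fin.zero + sum (term ∘ Fin.suc) ≈⟨ +-congʳ (term Fin.zero) (sum-init-last (term ∘ Fin.suc)) ⟩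
      term Fin.zero + (sum (init (term ∘ Fin.suc)) + last (term ∘ Fin.suc)) ∎
    first : term Fin.zero ≃ 1ℚᵘ
    first = ≃-trans (+-identityʳ _) (≃-trans (*-identityˡ _) (≃-trans (≃-reflexive (^≡^ᵘ 1ℚᵘ n)) (1^n≃1 n)))
    middle : ∀ i → p ∣ₚ init (term ∘ Fin.suc) i
    middle i = ∣⇒∣ₚ-× (subst (λ m → p ℕ.∣ m C k) (sym 1+q≡p) (p∣pCk ℕ.z<s k<p))
                      (subst Integral (sym (cong₂ _*_ (^≡^ᵘ x k) (^≡^ᵘ 1ℚᵘ (n ∸ k))))
                             (∣ₚ-*ˡ (^-Integral k x-int) (^-Integral (n ∸ k) (Integral-ι 1))))
      where
      k = suc (toℕ (inject₁ i))
      k<p : k < p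
      k<p = subst (k <_) 1+q≡p (ℕ.s<s (subst (_< q) (sym (Fin.toℕ-inject₁ i)) (Fin.toℕ<n i)))
    final : last (term ∘ Fin.suc) ≃ x ^ᵘ n
    final = begin
      f (toℕ (fromℕ n))                   ≡⟨ cong f (Fin.toℕ-fromℕ n) ⟩
      (n C n) ×ᵘ (x ^ n * 1ℚᵘ ^ (n ∸ n))  ≡⟨ cong₂ (λ c m → c ×ᵘ (x ^ n * 1ℚᵘ ^ m)) (nCn≡1 n) (ℕ.n∸n≡0 n) ⟩
      x ^ n * 1ℚᵘ + 0ℚᵘ                   ≈⟨ +-identityʳ _ ⟩
      x ^ n * 1ℚᵘ                         ≈⟨ *-identityʳ _ ⟩
      x ^ n                               ≡⟨ ^≡^ᵘ x n ⟩
      x ^ᵘ n                              ∎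
    rearrange : ∀ a → 1ℚᵘ + (0ℚᵘ + a) ≃ a + 1ℚᵘ
    rearrange = solve-∀ ℚᵘ-ring

  fermat : ∀ n → ι n ^ᵘ p ≡ₚ ι n
  fermat zero    = ≃⇒≡ₚ (0^p≃0 p {{prime⇒nonZero p-prime}})
    where
    0^p≃0 : ∀ m .{{_ : NonZero m}} → 0ℚᵘ ^ᵘ m ≃ 0ℚᵘ
    0^p≃0 (suc m) = *-zeroˡ (0ℚᵘ ^ᵘ m)
  fermat (suc n) = subst (λ y → y ^ᵘ p ≡ₚ y) (sym (ι-suc n))
    (≡ₚ-trans (frobenius (Integral-ι n)) (≡ₚ-+ (fermat n) ≡ₚ-refl))

≡2[mod3]⇒≡5[mod6] : ∀ {p} → Prime p → 5 ≤ p → p % 3 ≡ 2 → ∃ λ s → p ≡ 6 ℕ.* s ℕ.+ 5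
≡2[mod3]⇒≡5[mod6] {p} p-prime 5≤p p%3≡2 =
  by-parity (p ℕ./ 3) (trans (m≡m%n+[m/n]*n p 3) (cong (ℕ._+ p ℕ./ 3 ℕ.* 3) p%3≡2))
  where
  by-parity : ∀ u → p ≡ 2 ℕ.+ u ℕ.* 3 → ∃ λ s → p ≡ 6 ℕ.* s ℕ.+ 5
  by-parity u p≡2+3u with u % 2 | m%n<n u 2 | m≡m%n+[m/n]*n u 2
  ... | 0 | _ | u≡2w = contradiction (prime⇒irreducible p-prime (divides (1 ℕ.+ 3 ℕ.* (u ℕ./ 2)) even)) not-even
    where
    identity : ∀ w → 2 ℕ.+ (0 ℕ.+ w ℕ.* 2) ℕ.* 3 ≡ (1 ℕ.+ 3 ℕ.* w) ℕ.* 2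
    identity = ℕ-Solver.solve-∀
    even : p ≡ (1 ℕ.+ 3 ℕ.* (u ℕ./ 2)) ℕ.* 2
    even = trans p≡2+3u (trans (cong (λ u → 2 ℕ.+ u ℕ.* 3) u≡2w) (identity (u ℕ./ 2)))
    not-even : ¬ (2 ≡ 1 ⊎ 2 ≡ p)
    not-even (inj₁ ())
    not-even (inj₂ 2≡p) = ℕ.<⇒≱ (ℕ.s≤s (ℕ.s≤s (ℕ.s≤s ℕ.z≤n))) (subst (5 ≤_) (sym 2≡p) 5≤p)
  ... | 1 | _ | u≡1+2w = u ℕ./ 2 , trans p≡2+3u (trans (cong (λ u → 2 ℕ.+ u ℕ.* 3) u≡1+2w) (identity (u ℕ./ 2)))
    where
    identity : ∀ w → 2 ℕ.+ (1 ℕ.+ w ℕ.* 2) ℕ.* 3 ≡ 6 ℕ.* w ℕ.+ 5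
    identity = ℕ-Solver.solve-∀
  ... | suc (suc _) | ℕ.s≤s (ℕ.s≤s ()) | _

module PrimeOfForm6s+5 {p : ℕ} (p-prime : Prime p) (s : ℕ) (p≡6s+5 : p ≡ 6 ℕ.* s ℕ.+ 5) where
  open Congruences p-prime

  5≤p : 5 ≤ p
  5≤p = subst (5 ≤_) (sym p≡6s+5) (ℕ.m≤n+m 5 (6 ℕ.* s))

  ∤2 : ¬ (p ℕ.∣ 2)
  ∤2 = ∤-small ℕ.z<s (ℕ.≤-trans (ℕ.s≤s (ℕ.s≤s (ℕ.s≤s ℕ.z≤n))) 5≤p)

  ∤3 : ¬ (p ℕ.∣ 3)
  ∤3 = ∤-small ℕ.z<s (ℕ.≤-trans (ℕ.s≤s (ℕ.s≤s (ℕ.s≤s (ℕ.s≤s ℕ.z≤n)))) 5≤p)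

  ∤6 : ¬ (p ℕ.∣ 6)
  ∤6 = ∤-* ∤2 ∤3

  1/6-int : Integral (+ 1 / 6)
  1/6-int = Integral-/ 1 6 ∤6
  5/6-int : Integral (+ 5 / 6)
  5/6-int = Integral-/ 5 6 ∤6
  1/3-int : Integral (+ 1 / 3)
  1/3-int = Integral-/ 1 3 ∤3
  2/3-int : Integral (+ 2 / 3)
  2/3-int = Integral-/ 2 3 ∤3
  1/2-int : Integral (+ 1 / 2)
  1/2-int = Integral-/ 1 2 ∤2

  shift : ∀ e d t c .{{_ : NonZero d}} → d ℕ.* t ℕ.+ e ≡ (6 ℕ.* s ℕ.+ 5) ℕ.* c →
          + e / d + ι t ≃ ι p * (+ c / d)
  shift e d t c eq = fraction-shift e d t p c (trans eq (cong (ℕ._* c) (sym p≡6s+5)))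

  shift-1/6 : + 1 / 6 + ι (5 ℕ.* s ℕ.+ 4) ≃ ι p * (+ 5 / 6)
  shift-1/6 = shift 1 6 (5 ℕ.* s ℕ.+ 4) 5 (identity s)
    where
    identity : ∀ s → 6 ℕ.* (5 ℕ.* s ℕ.+ 4) ℕ.+ 1 ≡ (6 ℕ.* s ℕ.+ 5) ℕ.* 5
    identity = ℕ-Solver.solve-∀

  shift-1/3 : + 1 / 3 + ι (4 ℕ.* s ℕ.+ 3) ≃ ι p * (+ 2 / 3)
  shift-1/3 = shift 1 3 (4 ℕ.* s ℕ.+ 3) 2 (identity s)
    where
    identity : ∀ s → 3 ℕ.* (4 ℕ.* s ℕ.+ 3) ℕ.+ 1 ≡ (6 ℕ.* s ℕ.+ 5) ℕ.* 2
    identity = ℕ-Solver.solve-∀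

  shift-2/3 : + 2 / 3 + ι (2 ℕ.* s ℕ.+ 1) ≃ ι p * (+ 1 / 3)
  shift-2/3 = shift 2 3 (2 ℕ.* s ℕ.+ 1) 1 (identity s)
    where
    identity : ∀ s → 3 ℕ.* (2 ℕ.* s ℕ.+ 1) ℕ.+ 2 ≡ (6 ℕ.* s ℕ.+ 5) ℕ.* 1
    identity = ℕ-Solver.solve-∀

  shift-1/2 : + 1 / 2 + ι (3 ℕ.* s ℕ.+ 2) ≃ ι p * (+ 1 / 2)
  shift-1/2 = shift 1 2 (3 ℕ.* s ℕ.+ 2) 1 (identity s)
    where
    identity : ∀ s → 2 ℕ.* (3 ℕ.* s ℕ.+ 2) ℕ.+ 1 ≡ (6 ℕ.* s ℕ.+ 5) ℕ.* 1
    identity = ℕ-Solver.solve-∀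

  a*s+b<p : ∀ a b {_ : T (a ℕ.≤ᵇ 6)} {_ : T (b ℕ.≤ᵇ 4)} → a ℕ.* s ℕ.+ b < p
  a*s+b<p a b {a≤6} {b≤4} = subst (a ℕ.* s ℕ.+ b <_) (sym p≡6s+5)
    (ℕ.+-mono-≤-< (ℕ.*-monoˡ-≤ s (ℕ.≤ᵇ⇒≤ a 6 a≤6)) (ℕ.s≤s (ℕ.≤ᵇ⇒≤ b 4 b≤4)))

  i≤4s+3⇒2s+1<p∸i : ∀ {i} → i ≤ 4 ℕ.* s ℕ.+ 3 → 2 ℕ.* s ℕ.+ 1 < p ∸ i
  i≤4s+3⇒2s+1<p∸i {i} i≤4s+3 = ℕ.m+n≤o⇒m≤o∸n (suc (2 ℕ.* s ℕ.+ 1))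
    (subst (suc (2 ℕ.* s ℕ.+ 1) ℕ.+ i ≤_) (sym p≡6s+5)
      (ℕ.≤-trans (ℕ.+-monoʳ-≤ (suc (2 ℕ.* s ℕ.+ 1)) i≤4s+3) (ℕ.≤-reflexive (identity s))))
    where
    identity : ∀ s → suc (2 ℕ.* s ℕ.+ 1) ℕ.+ (4 ℕ.* s ℕ.+ 3) ≡ 6 ℕ.* s ℕ.+ 5
    identity = ℕ-Solver.solve-∀

  hypCoeff-Integral : ∀ {i} → i < p → Integral (hypCoeff i)
  hypCoeff-Integral {i} i<p =
    ∣ₚ-resp-≃ (≃-sym (hypCoeff≃ i)) (∣ₚ-*ʳ (pochRatio-Integral 1/6-int i<p) (pochRatio-Integral 1/3-int i<p))

  clausenCoeff-Integral : ∀ {k} → k < p → Integral (clausenCoeff k)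
  clausenCoeff-Integral k<p =
    ∣ₚ-*ʳ (∣ₚ-*ʳ (pochRatio-Integral 1/3-int k<p) (pochRatio-Integral 2/3-int k<p)) (pochRatio-Integral 1/2-int k<p)

  hypCoeff-vanishes : ∀ {i} → 4 ℕ.* s ℕ.+ 3 < i → i < p → p ∣ₚ hypCoeff i
  hypCoeff-vanishes {i} i>4s+3 i<p =
    ∣ₚ-resp-≃ (≃-sym (hypCoeff≃ i))
      (∣ₚ-*ˡ (pochRatio-Integral 1/6-int i<p)
             (pochRatio-vanishes (4 ℕ.* s ℕ.+ 3) 2/3-int shift-1/3 i>4s+3 i<p))

  clausenCoeff-vanishes : ∀ {k} → 2 ℕ.* s ℕ.+ 1 < k → k < p → p ∣ₚ clausenCoeff k
  clausenCoeff-vanishes k>2s+1 k<p =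
    ∣ₚ-*ʳ (∣ₚ-*ˡ (pochRatio-Integral 1/3-int k<p)
                 (pochRatio-vanishes (2 ℕ.* s ℕ.+ 1) 1/3-int shift-2/3 k>2s+1 k<p))
          (pochRatio-Integral 1/2-int k<p)

  hypCoeff[p]≡5/6*2/3 : hypCoeff p ≡ₚ + 5 / 6 * (+ 2 / 3)
  hypCoeff[p]≡5/6*2/3 = ≡ₚ-trans (≃⇒≡ₚ (hypCoeff≃ p))
    (≡ₚ-* 1/6-at-p 1/3-at-p (≡ₚ-Integral 1/6-at-p 5/6-int) 2/3-int)
    where
    1/6-at-p = pochRatio-at-p (5 ℕ.* s ℕ.+ 4) (a*s+b<p 5 4) 5/6-int shift-1/6
    1/3-at-p = pochRatio-at-p (4 ℕ.* s ℕ.+ 3) (a*s+b<p 4 3) 2/3-int shift-1/3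

  clausenCoeff[p]≡2/3*1/3*1/2 : clausenCoeff p ≡ₚ + 2 / 3 * (+ 1 / 3) * (+ 1 / 2)
  clausenCoeff[p]≡2/3*1/3*1/2 =
    ≡ₚ-* (≡ₚ-* 1/3-at-p 2/3-at-p (≡ₚ-Integral 1/3-at-p 2/3-int) 1/3-int) 1/2-at-p
         (∣ₚ-*ʳ (≡ₚ-Integral 1/3-at-p 2/3-int) (≡ₚ-Integral 2/3-at-p 1/3-int)) 1/2-int
    where
    1/3-at-p = pochRatio-at-p (4 ℕ.* s ℕ.+ 3) (a*s+b<p 4 3) 2/3-int shift-1/3
    2/3-at-p = pochRatio-at-p (2 ℕ.* s ℕ.+ 1) (a*s+b<p 2 1) 1/3-int shift-2/3
    1/2-at-p = pochRatio-at-p (3 ℕ.* s ℕ.+ 2) (a*s+b<p 3 2) 1/2-int shift-1/2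

  cubeCoeff[p]≡2/3 : cubeCoeff p ≡ₚ + 2 / 3
  cubeCoeff[p]≡2/3 = ≡ₚ-trans split (≡ₚ-trans (≡ₚ-+ G[0]≡ G[p]≡) (≃⇒≡ₚ (*≡* refl)))
    where
    q = 6 ℕ.* s ℕ.+ 4
    p≡1+q : p ≡ suc q
    p≡1+q = trans p≡6s+5 (ℕ.+-suc (6 ℕ.* s) 4)
    G : ℕ → ℚᵘ
    G i = hypCoeff i * clausenCoeff (p ∸ i)
    middle : ∀ i → 0 < i → i ≤ q → p ∣ₚ G i
    middle i 0<i i≤q = by-cases (i ℕ.≤? 4 ℕ.* s ℕ.+ 3)
      where
      i<p : i < p
      i<p = subst (i <_) (sym p≡1+q) (ℕ.s≤s i≤q)
      p-i<p : p ∸ i < p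
      p-i<p = ℕ.∸-monoʳ-< {p} {i} {0} 0<i (ℕ.<⇒≤ i<p)
      by-cases : Dec (i ≤ 4 ℕ.* s ℕ.+ 3) → p ∣ₚ G i
      by-cases (yes i≤4s+3) = ∣ₚ-*ˡ (hypCoeff-Integral i<p) (clausenCoeff-vanishes (i≤4s+3⇒2s+1<p∸i i≤4s+3) p-i<p)
      by-cases (no i≰4s+3)  = ∣ₚ-*ʳ (hypCoeff-vanishes (ℕ.≰⇒> i≰4s+3) i<p) (clausenCoeff-Integral p-i<p)
    split : cubeCoeff p ≡ₚ G 0 + G p
    split = ≡ₚ-trans (≃⇒≡ₚ (≃-trans (cubeCoeff≃ p) (≃-reflexive (cong (λ n → sumTo n G) p≡1+q))))
                     (≡ₚ-+ (sumTo-≡ₚ-head q G middle) (≃⇒≡ₚ (≃-reflexive (cong G (sym p≡1+q)))))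
    G[0]≡ : G 0 ≡ₚ 1ℚᵘ * (+ 2 / 3 * (+ 1 / 3) * (+ 1 / 2))
    G[0]≡ = ≡ₚ-* (≃⇒≡ₚ {hypCoeff 0} {1ℚᵘ} (*≡* refl)) clausenCoeff[p]≡2/3*1/3*1/2
                 (hypCoeff-Integral (a*s+b<p 0 0)) (∣ₚ-*ʳ (∣ₚ-*ʳ 2/3-int 1/3-int) 1/2-int)
    G[p]≡ : G p ≡ₚ + 5 / 6 * (+ 2 / 3) * 1ℚᵘ
    G[p]≡ = ≡ₚ-* hypCoeff[p]≡5/6*2/3
                 (≃⇒≡ₚ (≃-trans (≃-reflexive (cong clausenCoeff (ℕ.n∸n≡0 p))) (*≡* refl)))
                (≡ₚ-Integral hypCoeff[p]≡5/6*2/3 (∣ₚ-*ʳ 5/6-int 2/3-int)) (Integral-ι 1)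

  Amix[p]≡72 : Amix p ≡ₚ + 72 / 1
  Amix[p]≡72 = ≡ₚ-trans (≡ₚ-* (fermat 108) cubeCoeff[p]≡2/3 (^-Integral p (Integral-ι 108)) 2/3-int)
                        (≃⇒≡ₚ (*≡* refl))

  Amix[1]≃18 : Amix 1 ≃ + 18 / 1
  Amix[1]≃18 = *≡* refl

  Amix[p]-Amix[1]≡54 : Amix p - Amix 1 ≡ₚ + 54 / 1
  Amix[p]-Amix[1]≡54 = ≡ₚ-trans (≡ₚ-+ Amix[p]≡72 (≃⇒≡ₚ (-‿cong Amix[1]≃18))) (≃⇒≡ₚ (*≡* refl))

  ∤54 : ¬ (p ℕ.∣ 54)
  ∤54 = ∤-* ∤2 (∤-* ∤3 (∤-* ∤3 ∤3))

  Amix[p]-Amix[1]≢0 : ¬ (Amix p - Amix 1 ≡ₚ + 0 / 1)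
  Amix[p]-Amix[1]≢0 ≡0 = ∤54 (∣ₚ-ι⇒∣ (≡ₚ0⇒∣ₚ (≡ₚ-trans (≡ₚ-sym Amix[p]-Amix[1]≡54) ≡0)))

corollary5p5 : (p : ℕ) → Prime p → p ≥ 5 → p % 3 ≡ 2 →
    (Amix p ≡ᵘ (+ 72 / 1) [mod p ])
      × ((Amix p - Amix 1) ≡ᵘ (+ 54 / 1) [mod p ])
      × ¬ ((Amix p - Amix 1) ≡ᵘ (+ 0 / 1) [mod p ])
corollary5p5 p p-prime p≥5 p%3≡2 with ≡2[mod3]⇒≡5[mod6] p-prime p≥5 p%3≡2
... | s , p≡6s+5 = ≡ₚ⇒≡ᵘ Amix[p]≡72 , ≡ₚ⇒≡ᵘ Amix[p]-Amix[1]≡54 , Amix[p]-Amix[1]≢0 ∘ ≡ᵘ⇒≡ₚ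
  where
  open Congruences p-prime
  open PrimeOfForm6s+5 p-prime s p≡6s+5
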